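{- Let $G=(V,E)$ be a graph with threshold function $t:V\rightarrow\mathbb{N}$, let $S\subseteq V$, and let $C_i\subseteq V$ be a clique type class of $G$. Let $t(C_i)=\min\{t(v): v\in C_i\}$ and let $\alpha(C_i)$ be the number of vertices $v\in C_i$ with $t(v)=t(C_i)$. Suppose $|S\cap C_i|<\alpha(C_i)$ and let $u_0\in C_i\setminus S$ with $t(u_0)=t(C_i)$. Then every vertex $u\in C_i$ has fewer than $t(u)$ neighbours in $S$ if and only if $u_0$ has fewer than $t(C_i)$ neighbours in $S$.
   Context: Two distinct vertices $u,v$ have the same neighbourhood type if $N(u)\setminus\{v\}=N(v)\setminus\{u\}$. A type class is a set of vertices any two of which have the same neighbourhood type; a clique type class is a type class that induces a clique in $G$. -}

module Defs where

open import Data.Nat using (ℕ; _≤_; _<_)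
open import Data.Bool using (Bool; true; false)
open import Data.Fin using (Fin)
open import Data.Fin.Subset using (Subset; _∈_; _∉_; _∩_; _-_; ∣_∣)
open import Data.Vec using (tabulate)
open import Data.Product using (Σ; _×_)
open import Relation.Binary.PropositionalEquality using (_≡_; _≢_)
open import Relation.Nullary using (does)
open import Data.Nat.Properties using () renaming (_≟_ to _≟ℕ_)

record Graph (n : ℕ) : Set where
  field
    adj    : Fin n → Fin n → Bool
    sym    : ∀ u v → adj u v ≡ adj v u
    irrefl : ∀ v → adj v v ≡ false
open Graph public

N : ∀ {n} → Graph n → Fin n → Subset n
N G u = tabulate (adj G u)

SameType : ∀ {n} → Graph n → Fin n → Fin n → Set
SameType G u v = (N G u - v) ≡ (N G v - u)

TypeClass : ∀ {n} → Graph n → Subset n → Set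
TypeClass G C = ∀ u v → u ∈ C → v ∈ C → u ≢ v → SameType G u v

IsClique : ∀ {n} → Graph n → Subset n → Set
IsClique G C = ∀ u v → u ∈ C → v ∈ C → u ≢ v → adj G u v ≡ true

CliqueTypeClass : ∀ {n} → Graph n → Subset n → Set
CliqueTypeClass G C = TypeClass G C × IsClique G C

IsMinThreshold : ∀ {n} → (Fin n → ℕ) → Subset n → ℕ → Set
IsMinThreshold t C m = Σ (Fin _) (λ w → w ∈ C × t w ≡ m) × (∀ v → v ∈ C → m ≤ t v)

α : ∀ {n} → (Fin n → ℕ) → Subset n → ℕ → ℕ
α t C m = ∣ C ∩ tabulate (λ v → does (t v ≟ℕ m)) ∣

degIn : ∀ {n} → Graph n → Subset n → Fin n → ℕ
degIn G S u = ∣ N G u ∩ S ∣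

-- Any vertex u₀ ∉ S of a type class C sees every S-neighbour x of another u ∈ C:
-- x ≠ u₀ because x ∈ S, so x ∈ N(u) \ {u₀} = N(u₀) \ {u}. Hence u₀ has the most
-- neighbours in S, while its threshold t(u₀) = t(C) is the least one in C.
module Submission where

open import Defs
open import Data.Nat using (ℕ; _<_; _≤_)
open import Data.Nat.Properties using (≤-refl; ≤-<-trans; <-≤-trans)
open import Data.Fin using (Fin; _≟_)
open import Data.Fin.Subset using (Subset; _∈_; _∉_; _∩_; _-_; _⊆_; ⁅_⁆; ∣_∣)
open import Data.Fin.Subset.Properties
  using (x∈p∩q⁺; x∈p∩q⁻; p⊆q⇒∣p∣≤∣q∣; p─q⊆p; x∈p∧x≢y⇒x∈p-y)
open import Data.Product using (_,_)
open import Function.Bundles using (_⇔_; mk⇔)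
open import Relation.Binary.PropositionalEquality using (_≡_; refl; subst)
open import Relation.Nullary using (yes; no)

module _ {n} (G : Graph n) (S : Subset n) where

  sameType∧∉⇒N∩⊆N∩ : ∀ {u v} → SameType G v u → u ∉ S → N G v ∩ S ⊆ N G u ∩ S
  sameType∧∉⇒N∩⊆N∩ {u} {v} v~u u∉S {x} x∈Nv∩S with x∈p∩q⁻ (N G v) S x∈Nv∩S
  ... | x∈Nv , x∈S = x∈p∩q⁺ (p─q⊆p (N G u) ⁅ v ⁆ x∈Nu-v , x∈S)
    where
    x∈Nu-v : x ∈ N G u - v
    x∈Nu-v = subst (x ∈_) v~u (x∈p∧x≢y⇒x∈p-y x∈Nv λ { refl → u∉S x∈S })

  typeClass⇒degIn≤ : ∀ {C} → TypeClass G C → ∀ {u₀} → u₀ ∈ C → u₀ ∉ S →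
                     ∀ {u} → u ∈ C → degIn G S u ≤ degIn G S u₀
  typeClass⇒degIn≤ tc {u₀} u₀∈C u₀∉S {u} u∈C with u ≟ u₀
  ... | yes refl = ≤-refl
  ... | no u≢u₀  = p⊆q⇒∣p∣≤∣q∣ (sameType∧∉⇒N∩⊆N∩ (tc u u₀ u∈C u₀∈C u≢u₀) u₀∉S)

lemma2 : ∀ {n} (G : Graph n) (t : Fin n → ℕ) (S C : Subset n)
    → CliqueTypeClass G C
    → (m : ℕ) → IsMinThreshold t C m
    → ∣ S ∩ C ∣ < α t C m
    → (u₀ : Fin n) → u₀ ∈ C → u₀ ∉ S → t u₀ ≡ m
    → ((∀ u → u ∈ C → degIn G S u < t u) ⇔ (degIn G S u₀ < m))
lemma2 G t S C (tc , _) m (_ , m≤t) _ u₀ u₀∈C u₀∉S tu₀≡m = mk⇔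
  (λ all< → subst (degIn G S u₀ <_) tu₀≡m (all< u₀ u₀∈C))
  (λ u₀< u u∈C → <-≤-trans (≤-<-trans (typeClass⇒degIn≤ G S tc u₀∈C u₀∉S u∈C) u₀<)
                           (m≤t u u∈C))
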